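{- Let $a, b$ be integers with $2 \le a < b$ and $a \mid b$. Let $(e_k)_{k\ge1}$ be a sequence of integers such that $e_1 \ge 1$ and $a^{e_k} > b^{e_{k-1}}$ for all $k \ge 2$. Let $k \ge 1$, and suppose that $N$ is a positive integer divisible by $a^{e_k}$ but not by $b$. Then $c_b(N) \ge k$.
   Context: For an integer $b \ge 2$ and a nonnegative integer $N$, $c_b(N)$ denotes the number of nonzero digits in the base-$b$ expansion of $N$. -}

module Defs where

open import Data.Nat using (ℕ; zero; suc; _+_; _≡ᵇ_; NonZero)
open import Data.Nat.DivMod using (_/_; _%_)
open import Data.Bool using (true; false)

-- Number of nonzero base-b digits of n, computed with fuel.
-- Each step replaces n by n / b < n (for b ≥ 2, n > 0), so fuel n suffices.
nzDigitsFuel : (b : ℕ) → .{{_ : NonZero b}} → ℕ → ℕ → ℕ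
nzDigitsFuel b zero    n = 0
nzDigitsFuel b (suc f) zero = 0
nzDigitsFuel b (suc f) n@(suc _) with n % b ≡ᵇ 0
... | true  = nzDigitsFuel b f (n / b)
... | false = suc (nzDigitsFuel b f (n / b))

c : (b : ℕ) → .{{_ : NonZero b}} → ℕ → ℕ
c b N = nzDigitsFuel b N N

-- Split N at the b^m place, m = e_{k-1}: N = r + q·b^m with r = N mod b^m.
-- The digits of N are then those of r followed by those of q, and q > 0 because
-- N ≥ a^{e_k} > b^m.  Moreover a^m divides both N and b^m (as a ∣ b and m ≤ e_k),
-- hence r, while b ∤ r since b ∣ b^m and b ∤ N.  So r satisfies the hypotheses
-- for k - 1 and has strictly fewer nonzero digits than N; induct on k.
module Submission where

open import Defs
open import Data.Nat using (ℕ; zero; suc; _+_; _*_; _∸_; _^_; _≤_; _<_; _≥_; _≡ᵇ_; NonZero; z≤n; s≤s; >-nonZero)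
open import Data.Bool using (true; false)
open import Data.Nat.Properties
open import Data.Nat.DivMod
open import Data.Nat.Divisibility
open import Data.Nat.Induction using (<-wellFounded)
open import Data.Nat.Solver using (module +-*-Solver)
open import Data.Product using (∃-syntax; _×_; _,_)
open import Induction.WellFounded using (Acc; acc)
open import Relation.Nullary using (¬_; contradiction)
open import Relation.Binary.PropositionalEquality
open +-*-Solver using (solve; _:+_; _:*_; _:=_)

nonzeroDigit : ℕ → ℕ
nonzeroDigit zero    = 0
nonzeroDigit (suc _) = 1

^-monoˡ-∣ : ∀ {a b} m → a ∣ b → a ^ m ∣ b ^ m
^-monoˡ-∣ zero    a∣b = ∣-refl
^-monoˡ-∣ (suc m) a∣b = *-pres-∣ a∣b (^-monoˡ-∣ m a∣b)

m≤n⇒o^m∣o^n : ∀ o {m n} → m ≤ n → o ^ m ∣ o ^ n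
m≤n⇒o^m∣o^n o {m} {n} m≤n =
  subst (λ k → o ^ m ∣ o ^ k) (m+[n∸m]≡n m≤n)
        (subst (o ^ m ∣_) (sym (^-distribˡ-+-* o m (n ∸ m))) (m∣m*n (o ^ (n ∸ m))))

b∤n⇒n>0 : ∀ {b n} → ¬ b ∣ n → 0 < n
b∤n⇒n>0 {b} {zero} b∤0 = contradiction (b ∣0) b∤0
b∤n⇒n>0 {n = suc _} _ = s≤s z≤n

module Digits (b : ℕ) .{{_ : NonZero b}} (1<b : 1 < b) where

  n≤1+f⇒n/b≤f : ∀ {n f} .{{_ : NonZero n}} → n ≤ suc f → n / b ≤ f
  n≤1+f⇒n/b≤f {n} n≤1+f = ≤-pred (≤-trans (m/n<m n b 1<b) n≤1+f)

  nzDigitsFuel-irrelevant : ∀ {f g} n → n ≤ f → n ≤ g → nzDigitsFuel b f n ≡ nzDigitsFuel b g n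
  nzDigitsFuel-irrelevant {zero}  {zero}  n       _   _   = refl
  nzDigitsFuel-irrelevant {zero}  {suc _} zero    _   _   = refl
  nzDigitsFuel-irrelevant {suc _} {zero}  zero    _   _   = refl
  nzDigitsFuel-irrelevant {suc _} {suc _} zero    _   _   = refl
  nzDigitsFuel-irrelevant {suc f} {suc g} n@(suc _) n≤f n≤g with n % b ≡ᵇ 0
  ... | true  = nzDigitsFuel-irrelevant (n / b) (n≤1+f⇒n/b≤f n≤f) (n≤1+f⇒n/b≤f n≤g)
  ... | false = cong suc (nzDigitsFuel-irrelevant (n / b) (n≤1+f⇒n/b≤f n≤f) (n≤1+f⇒n/b≤f n≤g))

  c-unfold : ∀ n → c b n ≡ nonzeroDigit (n % b) + c b (n / b)
  c-unfold zero = sym (cong₂ (λ x y → nonzeroDigit x + c b y) (m*n%n≡0 0 b) (0/n≡0 b))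
  -- Abstracting n % b lets the ≡ᵇ test inside nzDigitsFuel compute.
  c-unfold n@(suc _) with n % b
  ... | zero  = nzDigitsFuel-irrelevant (n / b) (n≤1+f⇒n/b≤f ≤-refl) ≤-refl
  ... | suc _ = cong suc (nzDigitsFuel-irrelevant (n / b) (n≤1+f⇒n/b≤f ≤-refl) ≤-refl)

  c[x+K*b]≡nonzeroDigit[x]+c[K] : ∀ {x} K → x < b → c b (x + K * b) ≡ nonzeroDigit x + c b K
  c[x+K*b]≡nonzeroDigit[x]+c[K] {x} K x<b = begin
    c b (x + K * b)                                           ≡⟨ c-unfold (x + K * b) ⟩
    nonzeroDigit ((x + K * b) % b) + c b ((x + K * b) / b)    ≡⟨ cong₂ (λ d q → nonzeroDigit d + c b q) lastDigit rest ⟩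
    nonzeroDigit x + c b K                                    ∎
    where
    open ≡-Reasoning
    lastDigit : (x + K * b) % b ≡ x
    lastDigit = trans ([m+kn]%n≡m%n x K b) (m<n⇒m%n≡m x<b)
    rest : (x + K * b) / b ≡ K
    rest = trans (+-distrib-/-∣ʳ x (n∣m*n K)) (cong₂ _+_ (m<n⇒m/n≡0 x<b) (m*n/n≡m K b))

  c-pos : ∀ {n} → 0 < n → 1 ≤ c b n
  c-pos {n} = go (<-wellFounded n)
    where
    go : ∀ {n} → Acc _<_ n → 0 < n → 1 ≤ c b n
    go {n} (acc smaller) 0<n rewrite c-unfold n with n % b in n%b≡d
    ... | suc _ = s≤s z≤n
    ... | zero  = go (smaller (m/n<m n b 1<b)) (m≥n⇒m/n>0 b≤n)
      where
      instance _ = >-nonZero 0<n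
      b≤n : b ≤ n
      b≤n = ∣⇒≤ (m%n≡0⇒n∣m n b n%b≡d)

  c[r+q*b^m]≡c[r]+c[q] : ∀ m {r} q → r < b ^ m → c b (r + q * b ^ m) ≡ c b r + c b q
  c[r+q*b^m]≡c[r]+c[q] zero    {zero}  q _         = cong (c b) (*-identityʳ q)
  c[r+q*b^m]≡c[r]+c[q] zero    {suc _} q (s≤s ())
  c[r+q*b^m]≡c[r]+c[q] (suc m) {r}    q r<b^[1+m] = begin
    c b (r + q * b ^ suc m)                     ≡⟨ cong (c b) regroup ⟩
    c b (x + (R + q * b ^ m) * b)               ≡⟨ c[x+K*b]≡nonzeroDigit[x]+c[K] (R + q * b ^ m) x<b ⟩
    nonzeroDigit x + c b (R + q * b ^ m)        ≡⟨ cong (nonzeroDigit x +_) (c[r+q*b^m]≡c[r]+c[q] m q R<b^m) ⟩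
    nonzeroDigit x + (c b R + c b q)            ≡⟨ +-assoc (nonzeroDigit x) (c b R) (c b q) ⟨
    nonzeroDigit x + c b R + c b q              ≡⟨ cong (_+ c b q) (c[x+K*b]≡nonzeroDigit[x]+c[K] R x<b) ⟨
    c b (x + R * b) + c b q                     ≡⟨ cong (λ n → c b n + c b q) r≡x+R*b ⟨
    c b r + c b q                               ∎
    where
    open ≡-Reasoning
    x = r % b
    R = r / b
    x<b : x < b
    x<b = m%n<n r b
    r≡x+R*b : r ≡ x + R * b
    r≡x+R*b = m≡m%n+[m/n]*n r b
    R<b^m : R < b ^ m
    R<b^m = *-cancelʳ-< b R (b ^ m) (≤-<-trans (m/n*n≤m r b) (subst (r <_) (*-comm b (b ^ m)) r<b^[1+m]))
    regroup : r + q * b ^ suc m ≡ x + (R + q * b ^ m) * b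
    regroup = trans (cong (_+ q * b ^ suc m) r≡x+R*b)
      (solve 5 (λ x R q B P → (x :+ R :* B) :+ q :* (B :* P) := x :+ (R :+ q :* P) :* B) refl x R q b (b ^ m))

  descend : ∀ {a m E N} → a ∣ b → 1 ≤ m → b ^ m < a ^ E → a ^ E ∣ N → ¬ b ∣ N →
            ∃[ r ] a ^ m ∣ r × ¬ b ∣ r × suc (c b r) ≤ c b N
  descend {a} {m} {E} {N} a∣b 1≤m b^m<a^E a^E∣N b∤N = r , a^m∣r , b∤r , moreDigits
    where
    M = b ^ m
    instance
      _ = m^n≢0 b m
      _ = >-nonZero (b∤n⇒n>0 b∤N)
    r = N % M
    q = N / M
    N≡r+q*M : N ≡ r + q * M
    N≡r+q*M = m≡m%n+[m/n]*n N M
    b^m<N : M < N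
    b^m<N = <-≤-trans b^m<a^E (∣⇒≤ a^E∣N)
    m≤E : m ≤ E
    m≤E = ≮⇒≥ λ E<m → <-asym b^m<a^E (begin-strict
      a ^ E ≤⟨ ^-monoˡ-≤ E (∣⇒≤ a∣b) ⟩
      b ^ E <⟨ ^-monoʳ-< b 1<b E<m ⟩
      b ^ m ∎)
      where open ≤-Reasoning
    a^m∣r : a ^ m ∣ r
    a^m∣r = %-presˡ-∣ (∣-trans (m≤n⇒o^m∣o^n a m≤E) a^E∣N) (^-monoˡ-∣ m a∣b)
    b∣M : b ∣ M
    b∣M = subst (λ k → b ∣ b ^ k) (m+[n∸m]≡n 1≤m) (m∣m*n (b ^ (m ∸ 1)))
    b∤r : ¬ b ∣ r
    b∤r b∣r = b∤N (subst (b ∣_) (sym N≡r+q*M) (∣m∣n⇒∣m+n b∣r (∣n⇒∣m*n q b∣M)))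
    moreDigits : suc (c b r) ≤ c b N
    moreDigits = begin
      suc (c b r)     ≡⟨ +-comm 1 (c b r) ⟩
      c b r + 1       ≤⟨ +-monoʳ-≤ (c b r) (c-pos (m≥n⇒m/n>0 (<⇒≤ b^m<N))) ⟩
      c b r + c b q   ≡⟨ c[r+q*b^m]≡c[r]+c[q] m q (m%n<n N M) ⟨
      c b (r + q * M) ≡⟨ cong (c b) N≡r+q*M ⟨
      c b N           ∎
      where open ≤-Reasoning

module _ {a b : ℕ} .{{_ : NonZero b}} (1<b : 1 < b) (a∣b : a ∣ b)
         (e : ℕ → ℕ) (1≤e₁ : 1 ≤ e 1) (gaps : ∀ k → b ^ e (suc k) < a ^ e (suc (suc k))) where

  open Digits b 1<b

  1≤e : ∀ k → 1 ≤ e (suc k)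
  1≤e zero    = 1≤e₁
  1≤e (suc k) with e (suc (suc k)) | gaps k
  ... | zero  | b^e<1 = contradiction (m^n>0 b (e (suc k))) (<⇒≱ b^e<1)
  ... | suc _ | _     = s≤s z≤n

  c-lowerBound : ∀ k {N} → a ^ e (suc k) ∣ N → ¬ b ∣ N → suc k ≤ c b N
  c-lowerBound zero    _       b∤N = c-pos (b∤n⇒n>0 b∤N)
  c-lowerBound (suc k) a^e∣N b∤N with descend {E = e (suc (suc k))} a∣b (1≤e k) (gaps k) a^e∣N b∤N
  ... | r , a^e∣r , b∤r , moreDigits = ≤-trans (s≤s (c-lowerBound k a^e∣r b∤r)) moreDigits

theorem4p1 : (a b : ℕ) → .{{_ : NonZero b}} → 2 ≤ a → a < b → a ∣ b →
    (e : ℕ → ℕ) → 1 ≤ e 1 → (∀ k → 2 ≤ k → b ^ e (k ∸ 1) < a ^ e k) →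
    (k : ℕ) → 1 ≤ k → (N : ℕ) → 0 < N → a ^ e k ∣ N → ¬ (b ∣ N) →
    c b N ≥ k
theorem4p1 a b 2≤a a<b a∣b e 1≤e₁ growth zero    ()
-- The hypothesis 0 < N is implied by b ∤ N.
theorem4p1 a b 2≤a a<b a∣b e 1≤e₁ growth (suc k) _  N _ a^e∣N b∤N =
  c-lowerBound (<-trans 2≤a a<b) a∣b e 1≤e₁ gaps k a^e∣N b∤N
  where
  gaps : ∀ k → b ^ e (suc k) < a ^ e (suc (suc k))
  gaps k = growth (suc (suc k)) (s≤s (s≤s z≤n))
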